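{- Let $\phi:\mathbb P^1\to\mathbb P^1$ be a rational map of degree $d\ge2$ with an automorphism $h$ of prime order $p$, and let $K$ be a field over which $\phi$, $h$ and the points of $\mathrm{Fix}(h)$ are defined. (a) If $d>2$, then $\deg\widetilde{\Psi^*_{pN}}<\deg\Phi^*_{pN,\phi}$ for all $N\ge1$. (b) If $d=2$, then $\deg\widetilde{\Psi^*_{pN}}<\deg\Phi^*_{pN,\phi}$ for all $N>1$.
   Context: Write $\phi=[F_1:G_1]$ homogeneously, $\phi^N=[F_N:G_N]$. Dynatomic polynomial: $\Phi^*_{N,\phi}=\prod_{k\mid N}(yF_k-xG_k)^{\mu(N/k)}$. $\mathrm{Aut}(\phi)=\{h\in\mathrm{PGL}_2(\overline K):h^{ -1}\phi h=\phi\}$; $\mathrm{Fix}(h)=\{P_i=[x_i:y_i]\}$. For $h^j=[\alpha x+\beta y:\gamma x+\delta y]$, let $\phi^N-h^j$ denote $(\gamma x+\delta y)F_N-(\alpha x+\beta y)G_N$. Define $\Psi_{pN}=\prod_{j=1}^{p-1}(\phi^N-h^j)$, $\Psi^*_{pN}=\prod_{k\mid N,\ pk\nmid N}\Psi_{pk}^{\mu(N/k)}$, and $\widetilde{\Psi^*_{pN}}=\Psi^*_{pN}/\prod_{P_i\in\mathrm{Fix}(h)}(y_ix-x_iy)^{\delta_i}$ where $\delta_i=\mathrm{ord}_{(y_ix-x_iy)}\Psi^*_{pN}$. -}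

module Defs where

open import Level using (Level; _⊔_) renaming (suc to lsuc)
open import Algebra.Bundles using (CommutativeRing)
open import Data.Nat as ℕ using (ℕ; zero; suc; _∸_; _≤?_)
open import Data.Nat.DivMod using (_/_)
open import Data.Nat.Divisibility using (_∣_; _∣?_)
open import Data.Nat.Primality using (prime?)
open import Data.Integer as ℤ using (ℤ)
open import Data.Bool using (Bool; true; false; if_then_else_; _∧_)
open import Data.List using (List; []; _∷_; foldr; filter; upTo; map)
open import Data.List.Relation.Unary.All using (All)
open import Data.List.Relation.Unary.Any using (Any)
open import Data.List.Relation.Unary.AllPairs using (AllPairs)
open import Data.Product using (Σ; _×_; _,_; proj₁; proj₂)
open import Relation.Nullary using (¬_; yes; no; does; ¬?)
open import Relation.Nullary.Decidable using (_×-dec_)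
open import Relation.Binary.PropositionalEquality using (_≡_)

record Field (c ℓ : Level) : Set (lsuc (c ⊔ ℓ)) where
  field
    commutativeRing : CommutativeRing c ℓ
  open CommutativeRing commutativeRing public
  field
    1≉0     : ¬ (1# ≈ 0#)
    inverse : ∀ x → ¬ (x ≈ 0#) → Σ Carrier λ y → (x * y) ≈ 1#

_div_ : ℕ → ℕ → ℕ
n div zero    = 0
n div (suc k) = n / suc k

-- Möbius function: μ(n) = 0 if p² ∣ n for some prime p, otherwise
-- (-1)^(number of prime divisors of n).  (μ 0 = 1 is an irrelevant
-- convention; only n ≥ 1 is used.)
μ : ℕ → ℤ
μ n = foldr step (ℤ.+ 1) (upTo (suc n))
  where
  step : ℕ → ℤ → ℤ
  step q acc with does (prime? q) ∧ does (q ∣? n)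
  ... | false = acc
  ... | true  = if does ((q ℕ.* q) ∣? n) then ℤ.+ 0 else ℤ.- acc

sumℤ : List ℕ → (ℕ → ℤ) → ℤ
sumℤ ks f = foldr (λ k acc → f k ℤ.+ acc) (ℤ.+ 0) ks

divisors : ℕ → List ℕ
divisors n = filter (λ k → k ∣? n) (upTo (suc n))

divisorsNotP : ℕ → ℕ → List ℕ
divisorsNotP p N = filter (λ k → (k ∣? N) ×-dec ¬? ((p ℕ.* k) ∣? N)) (upTo (suc N))

range1 : ℕ → List ℕ
range1 p = map suc (upTo (p ∸ 1))

_<ℤ_ : ℤ → ℤ → Set
_<ℤ_ = ℤ._<_

module FieldDefs {c ℓ : Level} (𝔽 : Field c ℓ) where
  private
    open module F = Field 𝔽 using (_≈_; _+_; _*_; -_; 0#; 1#)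

  K : Set c
  K = Field.Carrier 𝔽

  Σ≤ : ℕ → (ℕ → K) → K
  Σ≤ zero    f = f 0
  Σ≤ (suc n) f = Σ≤ n f + f (suc n)

  -- a binary form of (homogeneous) degree `deg`:
  --   Σ_{i ≤ deg} coef i · x^i · y^(deg - i)
  -- (coefficients with index > deg are ignored, see `at`)
  record Form : Set c where
    constructor form
    field
      deg  : ℕ
      coef : ℕ → K
  open Form public

  at : Form → ℕ → K
  at (form n cf) i with i ≤? n
  ... | yes _ = cf i
  ... | no  _ = 0#

  _≈F_ : Form → Form → Set ℓ
  f ≈F g = (deg f ≡ deg g) × (∀ i → at f i ≈ at g i)

  _+F_ : Form → Form → Form      -- used for forms of equal degree
  f +F g = form (deg f) (λ i → at f i + at g i)

  _-F_ : Form → Form → Form      -- used for forms of equal degree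
  f -F g = form (deg f) (λ i → at f i + (- at g i))

  scaleF : K → Form → Form
  scaleF a f = form (deg f) (λ i → a * at f i)

  _*F_ : Form → Form → Form
  f *F g = form (deg f ℕ.+ deg g) (λ k → Σ≤ k (λ i → at f i * at g (k ∸ i)))

  oneF : Form
  oneF = form 0 (λ _ → 1#)

  _^F_ : Form → ℕ → Form
  f ^F zero  = oneF
  f ^F suc m = f *F (f ^F m)

  lin : K → K → Form
  lin a b = form 1 (λ { zero → b ; (suc _) → a })

  xF yF : Form
  xF = lin 1# 0#
  yF = lin 0# 1#

  -- F(P, Q) for a form F and forms P, Q of equal degree
  compose : Form → Form → Form → Form
  compose Fm P Q = form (deg Fm ℕ.* deg P)
    (λ k → Σ≤ (deg Fm) (λ i → at Fm i * at ((P ^F i) *F (Q ^F (deg Fm ∸ i))) k))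

  _∣F_ : Form → Form → Set (c ⊔ ℓ)
  g ∣F f = Σ Form λ q → (g *F q) ≈F f

  CoprimeF : Form → Form → Set (c ⊔ ℓ)
  CoprimeF Fm Gm = ∀ g → g ∣F Fm → g ∣F Gm → deg g ≡ 0

  iter : Form → Form → ℕ → Form × Form
  iter Fm Gm zero    = xF , yF
  iter Fm Gm (suc k) = compose Fm (proj₁ (iter Fm Gm k)) (proj₂ (iter Fm Gm k))
                     , compose Gm (proj₁ (iter Fm Gm k)) (proj₂ (iter Fm Gm k))

  -- 2×2 matrices [α β; γ δ], representing [x:y] ↦ [αx+βy : γx+δy]
  record Mat : Set c where
    constructor mat
    field
      α β γ δ : K
  open Mat public

  _·M_ : Mat → Mat → Mat
  mat a b c' d ·M mat a' b' c'' d' = mat (a * a' + b * c'') (a * b' + b * d')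
                                          (c' * a' + d * c'') (c' * b' + d * d')

  detM : Mat → K
  detM m = α m * δ m + (- (β m * γ m))

  idM : Mat
  idM = mat 1# 0# 0# 1#

  _^M_ : Mat → ℕ → Mat
  h ^M zero  = idM
  h ^M suc j = h ·M (h ^M j)

  -- the matrix represents the identity of PGL₂
  IsScalar : Mat → Set ℓ
  IsScalar m = (β m ≈ 0#) × (γ m ≈ 0#) × (α m ≈ δ m)

  HasOrder : Mat → ℕ → Set ℓ
  HasOrder h p = ¬ (detM h ≈ 0#) × IsScalar (h ^M p)
               × (∀ j → 0 ℕ.< j → j ℕ.< p → ¬ IsScalar (h ^M j))

  -- h ∈ Aut(φ), φ = [F:G]:  h⁻¹ φ h = φ, i.e. φ ∘ h = h ∘ φ in PGL-sense
  -- (the two coordinate pairs agree up to a nonzero scalar)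
  IsAut : Form → Form → Mat → Set (c ⊔ ℓ)
  IsAut Fm Gm h = Σ K λ s → ¬ (s ≈ 0#)
    × (compose Fm (lin (α h) (β h)) (lin (γ h) (δ h)) ≈F scaleF s (scaleF (α h) Fm +F scaleF (β h) Gm))
    × (compose Gm (lin (α h) (β h)) (lin (γ h) (δ h)) ≈F scaleF s (scaleF (γ h) Fm +F scaleF (δ h) Gm))

  -- points of ℙ¹(K) given by representatives (a , b) = [a:b]
  Pt : Set c
  Pt = K × K

  NonzeroPt : Pt → Set ℓ
  NonzeroPt (a , b) = ¬ ((a ≈ 0#) × (b ≈ 0#))

  SamePt : Pt → Pt → Set ℓ
  SamePt (a , b) (a' , b') = a * b' ≈ a' * b

  IsFixed : Mat → Pt → Set ℓ
  IsFixed h (a , b) = NonzeroPt (a , b)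
    × (a * (γ h * a + δ h * b) ≈ b * (α h * a + β h * b))

  fixForm : Mat → Form
  fixForm h = (xF *F lin (γ h) (δ h)) -F (yF *F lin (α h) (β h))

  -- all points of Fix(h) (over an algebraic closure) are defined over K:
  -- the fixed-point form splits into linear factors over K
  FixDefinedOverK : Mat → Set (c ⊔ ℓ)
  FixDefinedOverK h = Σ K λ a → Σ K λ b → Σ K λ a' → Σ K λ b' →
    fixForm h ≈F (lin a b *F lin a' b')

  IsFixList : Mat → List Pt → Set (c ⊔ ℓ)
  IsFixList h pts = All (IsFixed h) pts
    × AllPairs (λ P Q → ¬ SamePt P Q) pts
    × (∀ P → IsFixed h P → Any (SamePt P) pts)

  -- the linear form y_i x − x_i y vanishing at P_i = [x_i : y_i]
  ptLin : Pt → Form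
  ptLin (a , b) = lin b (- a)

  IsOrd : Form → Pt → ℕ → Set (c ⊔ ℓ)
  IsOrd f P m = ((ptLin P ^F m) ∣F f) × ¬ ((ptLin P ^F suc m) ∣F f)

  -- φ^k − h^j := (γ'x+δ'y)F_k − (α'x+β'y)G_k  where h^j = [α'x+β'y : γ'x+δ'y]
  psiForm : Form → Form → Mat → ℕ → ℕ → Form
  psiForm Fm Gm h k j =
    (lin (γ (h ^M j)) (δ (h ^M j)) *F proj₁ (iter Fm Gm k))
    -F (lin (α (h ^M j)) (β (h ^M j)) *F proj₂ (iter Fm Gm k))

  dynForm : Form → Form → ℕ → Form
  dynForm Fm Gm k = (yF *F proj₁ (iter Fm Gm k)) -F (xF *F proj₂ (iter Fm Gm k))

  degPhiStar : Form → Form → ℕ → ℤ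
  degPhiStar Fm Gm n =
    sumℤ (divisors n) (λ k → μ (n div k) ℤ.* ℤ.+ deg (dynForm Fm Gm k))

  degPsiStar : Form → Form → Mat → ℕ → ℕ → ℤ
  degPsiStar Fm Gm h p N =
    sumℤ (divisorsNotP p N) (λ k → μ (N div k) ℤ.*
      sumℤ (range1 p) (λ j → ℤ.+ deg (psiForm Fm Gm h k j)))

  -- δ_i = ord_{P_i} Ψ*_{pN} = Σ_{k ∣ N, pk ∤ N} μ(N/k) · Σ_j ord_{P_i}(φ^k − h^j),
  -- given the orders ord k j P = ord_P (φ^k − h^j)
  deltaPsiStar : ℕ → ℕ → (ℕ → ℕ → Pt → ℕ) → Pt → ℤ
  deltaPsiStar p N ord P =
    sumℤ (divisorsNotP p N) (λ k → μ (N div k) ℤ.*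
      sumℤ (range1 p) (λ j → ℤ.+ ord k j P))

  degPsiTilde : Form → Form → Mat → ℕ → ℕ → List Pt → (ℕ → ℕ → Pt → ℕ) → ℤ
  degPsiTilde Fm Gm h p N pts ord =
    degPsiStar Fm Gm h p N ℤ.- foldr (λ P acc → deltaPsiStar p N ord P ℤ.+ acc) (ℤ.+ 0) pts

module Submission where

-- A non-scalar h has fixed-point form x(γx + δy) − y(αx + βy), a nonzero quadratic form which
-- splits over K, so Fix(h) has at most two points.  Each φ^k − h^j has degree d^k + 1 and each
-- fixed point divides it at most that often, so removing the (at most two) fixed points changes
-- the k-th term μ(N/k)·(p − 1)(d^k + 1) of deg Ψ*_{pN} by at most its absolute value; hence
-- deg Ψ̃*_{pN} ≤ Σ_{k ∣ N, pk ∤ N} |μ(N/k)|(p − 1)(d^k + 1) ≤ N(p − 1)(d^N + 1).  On the other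
-- side, all proper divisors of pN are at most H = ⌊pN/2⌋, so deg Φ*_{pN} ≥ d^{pN} + 1 − (H + 1)(d^H + 1).
-- The two bounds separate as soon as d^H ≥ 3(H + 1); the finitely many remaining (d, p, N) are
-- settled by evaluation, and only there is the hypothesis excluding d = 2, N = 1 needed.

open import Defs
open import Level using (Level)
open import Function using (_∘_)
open import Data.Nat as ℕ using (ℕ; zero; suc; z≤n; s≤s; _∸_; _^_; ⌊_/2⌋; ⌈_/2⌉; NonZero)
import Data.Nat.Properties as ℕₚ
import Data.Nat.Solver
import Data.Integer.Properties as ℤₚ
open import Data.Integer.Solver using (module +-*-Solver)
open import Data.Bool using (true; false; if_then_else_; _∧_)
open import Data.List using (List; []; _∷_; _++_; foldr; filter; upTo; applyUpTo; length; map)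
open import Data.List.Properties
  using (length-map; length-upTo; length-filter; length-applyUpTo; filter-reject; upTo-∷ʳ)
open import Data.List.Membership.Propositional using (_∈_)
open import Data.List.Membership.Propositional.Properties using (∈-filter⁻; ∈-map⁻; ∈-upTo⁻; ∈-applyUpTo⁻)
open import Data.List.Relation.Unary.Any using (here; there)
open import Data.Nat.Divisibility using (_∣_; _∣?_; ∣-refl; ∣⇒≤; 0∣⇒≡0; quotient>1; m∣n⇒n≡m*quotient; quotient)
open import Data.Nat.DivMod using (n/n≡1)
open import Data.Nat.Primality using (Prime; prime?; prime⇒nonTrivial)
open import Data.Product using (∃; _×_; _,_; proj₁; proj₂)
open import Data.Empty using (⊥; ⊥-elim)
open import Relation.Nullary using (¬_; Dec; yes; no; does)
open import Relation.Nullary.Decidable using (_×-dec_; ¬?; _→-dec_; dec-true; toWitness; ¬¬-excluded-middle)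
open import Relation.Unary using (Pred; Decidable)
open import Relation.Binary.PropositionalEquality using (_≡_; refl; sym; trans; cong; cong₂; subst; module ≡-Reasoning)

⌈n/2⌉≤1+⌊n/2⌋ : ∀ n → ⌈ n /2⌉ ℕ.≤ suc ⌊ n /2⌋
⌈n/2⌉≤1+⌊n/2⌋ zero          = z≤n
⌈n/2⌉≤1+⌊n/2⌋ (suc zero)    = s≤s z≤n
⌈n/2⌉≤1+⌊n/2⌋ (suc (suc n)) = s≤s (⌈n/2⌉≤1+⌊n/2⌋ n)

n≤⌊n/2⌋+1+⌊n/2⌋ : ∀ n → n ℕ.≤ ⌊ n /2⌋ ℕ.+ suc ⌊ n /2⌋
n≤⌊n/2⌋+1+⌊n/2⌋ n = subst (ℕ._≤ ⌊ n /2⌋ ℕ.+ suc ⌊ n /2⌋) (ℕₚ.⌊n/2⌋+⌈n/2⌉≡n n)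
                          (ℕₚ.+-monoʳ-≤ ⌊ n /2⌋ (⌈n/2⌉≤1+⌊n/2⌋ n))

⌊n/2⌋+⌊n/2⌋≤n : ∀ n → ⌊ n /2⌋ ℕ.+ ⌊ n /2⌋ ℕ.≤ n
⌊n/2⌋+⌊n/2⌋≤n n = subst (⌊ n /2⌋ ℕ.+ ⌊ n /2⌋ ℕ.≤_) (ℕₚ.⌊n/2⌋+⌈n/2⌉≡n n)
                        (ℕₚ.+-monoʳ-≤ ⌊ n /2⌋ (ℕₚ.⌊n/2⌋≤⌈n/2⌉ n))

⌊n/2⌋<n : ∀ n .{{_ : NonZero n}} → ⌊ n /2⌋ ℕ.< n
⌊n/2⌋<n (suc n) = ℕₚ.⌊n/2⌋<n n

m+m≤n⇒m≤⌊n/2⌋ : ∀ {m n} → m ℕ.+ m ℕ.≤ n → m ℕ.≤ ⌊ n /2⌋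
m+m≤n⇒m≤⌊n/2⌋ {m} {n} m+m≤n = subst (ℕ._≤ ⌊ n /2⌋) (sym (ℕₚ.n≡⌊n+n/2⌋ m)) (ℕₚ.⌊n/2⌋-mono m+m≤n)

n≤⌊pn/2⌋ : ∀ p n → 2 ℕ.≤ p → n ℕ.≤ ⌊ p ℕ.* n /2⌋
n≤⌊pn/2⌋ p n 2≤p = m+m≤n⇒m≤⌊n/2⌋ (ℕₚ.≤-trans (ℕₚ.≤-reflexive (cong (n ℕ.+_) (sym (ℕₚ.+-identityʳ n))))
                                              (ℕₚ.*-monoˡ-≤ n 2≤p))

n[p∸1]≤2⌊pn/2⌋ : ∀ p n .{{_ : NonZero n}} → n ℕ.* (p ∸ 1) ℕ.≤ ⌊ p ℕ.* n /2⌋ ℕ.+ ⌊ p ℕ.* n /2⌋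
n[p∸1]≤2⌊pn/2⌋ p n = begin
  n ℕ.* (p ∸ 1)             ≡⟨ ℕₚ.*-distribˡ-∸ n p 1 ⟩
  n ℕ.* p ∸ n ℕ.* 1         ≡⟨ cong₂ _∸_ (ℕₚ.*-comm n p) (ℕₚ.*-identityʳ n) ⟩
  M ∸ n                     ≤⟨ ℕₚ.∸-monoˡ-≤ n (n≤⌊n/2⌋+1+⌊n/2⌋ M) ⟩
  H ℕ.+ suc H ∸ n           ≤⟨ ℕₚ.∸-monoʳ-≤ (H ℕ.+ suc H) (ℕ.>-nonZero⁻¹ n) ⟩
  H ℕ.+ suc H ∸ 1           ≡⟨ cong (_∸ 1) (ℕₚ.+-suc H H) ⟩
  H ℕ.+ H                   ∎
  where
  open ℕₚ.≤-Reasoning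
  M = p ℕ.* n
  H = ⌊ M /2⌋

proper-divisor≤⌊n/2⌋ : ∀ {k n} → k ∣ n → k ℕ.< n → k ℕ.≤ ⌊ n /2⌋
proper-divisor≤⌊n/2⌋ {k} {n} k∣n k<n = m+m≤n⇒m≤⌊n/2⌋ (begin
  k ℕ.+ k             ≡⟨ cong (k ℕ.+_) (ℕₚ.+-identityʳ k) ⟨
  2 ℕ.* k             ≡⟨ ℕₚ.*-comm 2 k ⟩
  k ℕ.* 2             ≤⟨ ℕₚ.*-monoʳ-≤ k (quotient>1 k∣n k<n) ⟩
  k ℕ.* quotient k∣n  ≡⟨ m∣n⇒n≡m*quotient k∣n ⟨
  n                   ∎)
  where open ℕₚ.≤-Reasoning

n-div-n≡1 : ∀ n .{{_ : NonZero n}} → n div n ≡ 1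
n-div-n≡1 (suc n) = n/n≡1 (suc n)

prime⇒2≤p : ∀ {p} → Prime p → 2 ℕ.≤ p
prime⇒2≤p {p} p-prime = ℕ.nonTrivial⇒n>1 p {{prime⇒nonTrivial p-prime}}

3[n+1]≤2^n : ∀ n → 4 ℕ.≤ n → 3 ℕ.* suc n ℕ.≤ 2 ^ n
3[n+1]≤2^n n 4≤n = subst (λ m → 3 ℕ.* suc m ℕ.≤ 2 ^ m) (ℕₚ.m+[n∸m]≡n 4≤n) (from-4 (n ∸ 4))
  where
  from-4 : ∀ k → 3 ℕ.* suc (4 ℕ.+ k) ℕ.≤ 2 ^ (4 ℕ.+ k)
  from-4 zero    = toWitness {a? = 15 ℕ.≤? 16} _
  from-4 (suc k) = begin
    3 ℕ.* suc (5 ℕ.+ k)                  ≡⟨ ℕₚ.*-distribˡ-+ 3 1 (suc (4 ℕ.+ k)) ⟩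
    3 ℕ.+ 3 ℕ.* suc (4 ℕ.+ k)            ≤⟨ ℕₚ.+-mono-≤ (ℕₚ.≤-trans (ℕₚ.m≤m*n 3 (suc (4 ℕ.+ k))) (from-4 k)) (from-4 k) ⟩
    2 ^ (4 ℕ.+ k) ℕ.+ 2 ^ (4 ℕ.+ k)      ≡⟨ cong (2 ^ (4 ℕ.+ k) ℕ.+_) (ℕₚ.+-identityʳ _) ⟨
    2 ^ (5 ℕ.+ k)                        ∎
    where open ℕₚ.≤-Reasoning

3[H+1]≤X⇒[3H+1][X+1]<X²+1 : ∀ H X → 3 ℕ.* suc H ℕ.≤ X → (H ℕ.+ H ℕ.+ suc H) ℕ.* suc X ℕ.< suc (X ℕ.* X)
3[H+1]≤X⇒[3H+1][X+1]<X²+1 H X 3[H+1]≤X = s≤s (ℕₚ.+-cancelʳ-≤ X _ _ (begin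
  K ℕ.* suc X ℕ.+ X                    ≤⟨ ℕₚ.+-monoʳ-≤ (K ℕ.* suc X) (ℕₚ.m≤m+n X (suc (suc X))) ⟩
  K ℕ.* suc X ℕ.+ (X ℕ.+ suc (suc X))
    ≡⟨ solve 2 (λ k x → k :* (con 1 :+ x) :+ (x :+ (con 2 :+ x)) := (k :+ con 2) :* (con 1 :+ x)) refl K X ⟩
  (K ℕ.+ 2) ℕ.* suc X
    ≡⟨ cong (ℕ._* suc X) (solve 1 (λ h → h :+ h :+ (con 1 :+ h) :+ con 2 := con 3 :* (con 1 :+ h)) refl H) ⟩
  3 ℕ.* suc H ℕ.* suc X                ≤⟨ ℕₚ.*-monoˡ-≤ (suc X) 3[H+1]≤X ⟩
  X ℕ.* suc X                          ≡⟨ solve 1 (λ x → x :* (con 1 :+ x) := x :* x :+ x) refl X ⟩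
  X ℕ.* X ℕ.+ X                        ∎))
  where
  open ℕₚ.≤-Reasoning
  open Data.Nat.Solver.+-*-Solver using (solve; _:+_; _:*_; _:=_; con)
  K = H ℕ.+ H ℕ.+ suc H

small-parameters : ∀ p d N → 2 ℕ.≤ p → 2 ℕ.≤ d → 1 ℕ.≤ N →
  ¬ (3 ℕ.* suc ⌊ p ℕ.* N /2⌋ ℕ.≤ d ^ ⌊ p ℕ.* N /2⌋) → d ℕ.< 12 × p ℕ.< 8 × N ℕ.< 8
small-parameters p d N 2≤p 2≤d 1≤N small = d<12 , p<8 , N<8
  where
  M = p ℕ.* N
  H = ⌊ M /2⌋
  instance
    d≢0 : NonZero d
    d≢0 = ℕ.>-nonZero (ℕₚ.<-≤-trans (s≤s z≤n) 2≤d)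
    N≢0 : NonZero N
    N≢0 = ℕ.>-nonZero 1≤N

  1≤H : 1 ℕ.≤ H
  1≤H = ℕₚ.≤-trans 1≤N (n≤⌊pn/2⌋ p N 2≤p)

  H≤3 : H ℕ.≤ 3
  H≤3 = ℕₚ.≮⇒≥ λ 3<H → small (ℕₚ.≤-trans (3[n+1]≤2^n H 3<H) (ℕₚ.^-monoˡ-≤ H 2≤d))

  d<12 : d ℕ.< 12
  d<12 = begin-strict
    d               ≡⟨ ℕₚ.*-identityʳ d ⟨
    d ^ 1           ≤⟨ ℕₚ.^-monoʳ-≤ d 1≤H ⟩
    d ^ H           <⟨ ℕₚ.≰⇒> small ⟩
    3 ℕ.* suc H     ≤⟨ ℕₚ.*-monoʳ-≤ 3 (s≤s H≤3) ⟩
    12              ∎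
    where open ℕₚ.≤-Reasoning

  M≤7 : M ℕ.≤ 7
  M≤7 = ℕₚ.≤-trans (n≤⌊n/2⌋+1+⌊n/2⌋ M) (ℕₚ.+-mono-≤ H≤3 (s≤s H≤3))

  p<8 : p ℕ.< 8
  p<8 = s≤s (ℕₚ.≤-trans (ℕₚ.m≤m*n p N) M≤7)

  N<8 : N ℕ.< 8
  N<8 = s≤s (ℕₚ.≤-trans (ℕₚ.m≤n*m N p {{ℕ.>-nonZero (ℕₚ.<-≤-trans (s≤s z≤n) 2≤p)}}) M≤7)

applyUpTo-+ : ∀ {a} {A : Set a} (f : ℕ → A) m n →
              applyUpTo f (m ℕ.+ n) ≡ applyUpTo f m ++ applyUpTo (f ∘ (m ℕ.+_)) n
applyUpTo-+ f zero    n = refl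
applyUpTo-+ f (suc m) n = cong (f 0 ∷_) (applyUpTo-+ (f ∘ suc) m n)

length-range1 : ∀ p → length (range1 p) ≡ p ∸ 1
length-range1 p = trans (length-map suc (upTo (p ∸ 1))) (length-upTo (p ∸ 1))

∈-range1⁻ : ∀ p {j} → j ∈ range1 p → 1 ℕ.≤ j × j ℕ.< p
∈-range1⁻ (suc p) j∈ with ∈-map⁻ suc j∈
... | i , i∈ , refl = s≤s z≤n , s≤s (∈-upTo⁻ i∈)

∈-divisorsNotP⁻ : ∀ p N {k} → k ∈ divisorsNotP p N → k ∣ N
∈-divisorsNotP⁻ p N k∈ =
  proj₁ (proj₂ (∈-filter⁻ (λ k → (k ∣? N) ×-dec ¬? ((p ℕ.* k) ∣? N)) {xs = upTo (suc N)} k∈))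

length-divisorsNotP : ∀ p N .{{_ : NonZero N}} → length (divisorsNotP p N) ℕ.≤ N
length-divisorsNotP p N = begin
  length (divisorsNotP p N)             ≡⟨ cong length (filter-reject P? {xs = applyUpTo suc N} 0∤N) ⟩
  length (filter P? (applyUpTo suc N))  ≤⟨ length-filter P? (applyUpTo suc N) ⟩
  length (applyUpTo suc N)              ≡⟨ length-applyUpTo suc N ⟩
  N                                     ∎
  where
  open ℕₚ.≤-Reasoning
  P? = λ k → (k ∣? N) ×-dec ¬? ((p ℕ.* k) ∣? N)
  0∤N : ¬ (0 ∣ N × ¬ (p ℕ.* 0 ∣ N))
  0∤N (0∣N , _) = ℕ.≢-nonZero⁻¹ N (0∣⇒≡0 0∣N)

module IntegerSums where
  open import Data.Integer using (ℤ; +_; 0ℤ; _+_; _-_; _*_; -_; _≤_)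
  open import Algebra.Properties.CommutativeSemigroup ℤₚ.+-commutativeSemigroup using (interchange)

  ∑ : ∀ {a} {A : Set a} → List A → (A → ℤ) → ℤ
  ∑ xs f = foldr (λ x acc → f x + acc) 0ℤ xs

  module _ {a} {A : Set a} where

    ∑-cong : ∀ xs {f g : A → ℤ} → (∀ x → f x ≡ g x) → ∑ xs f ≡ ∑ xs g
    ∑-cong []       f≗g = refl
    ∑-cong (x ∷ xs) f≗g = cong₂ _+_ (f≗g x) (∑-cong xs f≗g)

    ∑-mono-≤ : ∀ xs {f g : A → ℤ} → (∀ {x} → x ∈ xs → f x ≤ g x) → ∑ xs f ≤ ∑ xs g
    ∑-mono-≤ []       f≤g = ℤₚ.≤-refl
    ∑-mono-≤ (x ∷ xs) f≤g = ℤₚ.+-mono-≤ (f≤g (here refl)) (∑-mono-≤ xs (f≤g ∘ there))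

    ∑-nonneg : ∀ xs {f : A → ℤ} → (∀ {x} → x ∈ xs → 0ℤ ≤ f x) → 0ℤ ≤ ∑ xs f
    ∑-nonneg []       0≤f = ℤₚ.≤-refl
    ∑-nonneg (x ∷ xs) 0≤f = ℤₚ.+-mono-≤ (0≤f (here refl)) (∑-nonneg xs (0≤f ∘ there))

    ∑-const : ∀ xs c → ∑ xs (λ (_ : A) → + c) ≡ + (length xs ℕ.* c)
    ∑-const []       c = refl
    ∑-const (x ∷ xs) c = cong (_+_ (+ c)) (∑-const xs c)

    ∑-≤-length* : ∀ xs {f : A → ℤ} c → (∀ {x} → x ∈ xs → f x ≤ + c) → ∑ xs f ≤ + (length xs ℕ.* c)
    ∑-≤-length* xs c f≤c = ℤₚ.≤-trans (∑-mono-≤ xs f≤c) (ℤₚ.≤-reflexive (∑-const xs c))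

    ∑-neg : ∀ xs (f : A → ℤ) → ∑ xs (λ x → - f x) ≡ - ∑ xs f
    ∑-neg []       f = refl
    ∑-neg (x ∷ xs) f = trans (cong (_+_ (- f x)) (∑-neg xs f)) (sym (ℤₚ.neg-distrib-+ (f x) _))

    ∑-≥-length* : ∀ xs {f : A → ℤ} c → (∀ {x} → x ∈ xs → - + c ≤ f x) → - + (length xs ℕ.* c) ≤ ∑ xs f
    ∑-≥-length* xs c c≤f = ℤₚ.≤-trans
      (ℤₚ.≤-reflexive (trans (cong -_ (sym (∑-const xs c))) (sym (∑-neg xs (λ _ → + c)))))
      (∑-mono-≤ xs c≤f)

    ∑-++ : ∀ xs ys (f : A → ℤ) → ∑ (xs ++ ys) f ≡ ∑ xs f + ∑ ys f
    ∑-++ []       ys f = sym (ℤₚ.+-identityˡ (∑ ys f))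
    ∑-++ (x ∷ xs) ys f = trans (cong (_+_ (f x)) (∑-++ xs ys f)) (sym (ℤₚ.+-assoc (f x) _ _))

    ∑-filter : ∀ {p} {P : Pred A p} (P? : Decidable P) xs (f : A → ℤ) →
               ∑ (filter P? xs) f ≡ ∑ xs (λ x → if does (P? x) then f x else 0ℤ)
    ∑-filter P? []       f = refl
    ∑-filter P? (x ∷ xs) f with does (P? x)
    ... | true  = cong (_+_ (f x)) (∑-filter P? xs f)
    ... | false = trans (∑-filter P? xs f) (sym (ℤₚ.+-identityˡ _))

    ∑-distrib-+ : ∀ xs (f g : A → ℤ) → ∑ xs (λ x → f x + g x) ≡ ∑ xs f + ∑ xs g
    ∑-distrib-+ []       f g = refl
    ∑-distrib-+ (x ∷ xs) f g =
      trans (cong (_+_ (f x + g x)) (∑-distrib-+ xs f g)) (interchange (f x) (g x) _ _)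

    ∑-distrib-- : ∀ xs (f g : A → ℤ) → ∑ xs (λ x → f x - g x) ≡ ∑ xs f - ∑ xs g
    ∑-distrib-- xs f g = trans (∑-distrib-+ xs f (λ x → - g x)) (cong (_+_ (∑ xs f)) (∑-neg xs g))

    ∑-*ˡ : ∀ xs c (f : A → ℤ) → ∑ xs (λ x → c * f x) ≡ c * ∑ xs f
    ∑-*ˡ []       c f = sym (ℤₚ.*-zeroʳ c)
    ∑-*ˡ (x ∷ xs) c f = trans (cong (_+_ (c * f x)) (∑-*ˡ xs c f)) (sym (ℤₚ.*-distribˡ-+ c (f x) _))

  ∑-comm : ∀ {a b} {A : Set a} {B : Set b} xs ys (f : A → B → ℤ) →
           ∑ xs (λ x → ∑ ys (f x)) ≡ ∑ ys (λ y → ∑ xs (λ x → f x y))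
  ∑-comm []       ys f = sym (trans (∑-const ys 0) (cong +_ (ℕₚ.*-zeroʳ (length ys))))
  ∑-comm (x ∷ xs) ys f = trans (cong (_+_ (∑ ys (f x))) (∑-comm xs ys f))
                               (sym (∑-distrib-+ ys (f x) _))

module AbsoluteValue where
  open import Data.Integer using (ℤ; +_; -[1+_]; 0ℤ; ∣_∣; +≤+; -≤+; -≤-; _+_; _-_; _*_; -_; _≤_)
  open +-*-Solver using (solve; _:=_; _:+_; _:*_; _:-_; :-_)

  i≤∣i∣ : ∀ i → i ≤ + ∣ i ∣
  i≤∣i∣ (+ n)    = ℤₚ.≤-refl
  i≤∣i∣ -[1+ n ] = -≤+

  ∣i∣≤n⇒-n≤i : ∀ {i n} → ∣ i ∣ ℕ.≤ n → - (+ n) ≤ i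
  ∣i∣≤n⇒-n≤i {+ m}      _          = ℤₚ.neg-≤-pos
  ∣i∣≤n⇒-n≤i { -[1+ m ]} (s≤s m≤n) = -≤- m≤n

  -n≤i≤n⇒∣i∣≤n : ∀ {i n} → - (+ n) ≤ i → i ≤ + n → ∣ i ∣ ℕ.≤ n
  -n≤i≤n⇒∣i∣≤n {+ m}      _          (+≤+ m≤n) = m≤n
  -n≤i≤n⇒∣i∣≤n { -[1+ m ]} {suc n} (-≤- m≤n) _ = s≤s m≤n

  m*s-m*σ≤∣m∣*s : ∀ m s {σ} → 0ℤ ≤ σ → σ ≤ + s + + s → m * + s - m * σ ≤ + (∣ m ∣ ℕ.* s)
  m*s-m*σ≤∣m∣*s m s {σ} 0≤σ σ≤2s = begin
    m * + s - m * σ           ≡⟨ solve 3 (λ m s σ → m :* s :- m :* σ := m :* (s :- σ)) refl m (+ s) σ ⟩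
    m * (+ s - σ)             ≤⟨ i≤∣i∣ _ ⟩
    + ∣ m * (+ s - σ) ∣       ≡⟨ cong +_ (ℤₚ.abs-* m _) ⟩
    + (∣ m ∣ ℕ.* ∣ + s - σ ∣) ≤⟨ +≤+ (ℕₚ.*-monoʳ-≤ ∣ m ∣ (-n≤i≤n⇒∣i∣≤n -s≤s-σ s-σ≤s)) ⟩
    + (∣ m ∣ ℕ.* s)           ∎
    where
    open ℤₚ.≤-Reasoning
    -s≤s-σ : - + s ≤ + s - σ
    -s≤s-σ = begin
      - + s                 ≡⟨ solve 1 (λ s → :- s := s :- (s :+ s)) refl (+ s) ⟩
      + s - (+ s + + s)     ≤⟨ ℤₚ.+-monoʳ-≤ (+ s) (ℤₚ.neg-mono-≤ σ≤2s) ⟩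
      + s - σ               ∎

    s-σ≤s : + s - σ ≤ + s
    s-σ≤s = begin
      + s - σ               ≤⟨ ℤₚ.+-monoʳ-≤ (+ s) (ℤₚ.neg-mono-≤ 0≤σ) ⟩
      + s - 0ℤ              ≡⟨ ℤₚ.+-identityʳ (+ s) ⟩
      + s                   ∎

module Möbius where
  open import Data.Integer using (+_; ∣_∣; _*_; -_; _≤_)
  open AbsoluteValue

  -- μ's local step function cannot be named, so unification extracts it; the factor q = 0 of
  -- the fold over upTo (suc n) drops out because 0 is not prime.
  μ-as-foldr : ∀ n → ∃ λ step → μ n ≡ foldr step (+ 1) (applyUpTo suc n)
  μ-as-foldr n = _ , refl

  ∣μ∣≤1 : ∀ n → ∣ μ n ∣ ℕ.≤ 1
  ∣μ∣≤1 n = fold-bounded (applyUpTo suc n)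
    where
    step = proj₁ (μ-as-foldr n)

    step-bounded : ∀ q {acc} → ∣ acc ∣ ℕ.≤ 1 → ∣ step q acc ∣ ℕ.≤ 1
    step-bounded q {acc} ∣acc∣≤1 with does (prime? q) ∧ does (q ∣? n)
    ... | false = ∣acc∣≤1
    ... | true with does ((q ℕ.* q) ∣? n)
    ...   | true  = z≤n
    ...   | false = subst (ℕ._≤ 1) (sym (ℤₚ.∣-i∣≡∣i∣ acc)) ∣acc∣≤1

    fold-bounded : ∀ qs → ∣ foldr step (+ 1) qs ∣ ℕ.≤ 1
    fold-bounded []       = s≤s z≤n
    fold-bounded (q ∷ qs) = step-bounded q (fold-bounded qs)

  ∣μ∣*n≤n : ∀ m n → ∣ μ m ∣ ℕ.* n ℕ.≤ n
  ∣μ∣*n≤n m n = ℕₚ.≤-trans (ℕₚ.*-monoˡ-≤ n (∣μ∣≤1 m)) (ℕₚ.≤-reflexive (ℕₚ.*-identityˡ n))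

  -n≤μ*n : ∀ m n → - + n ≤ μ m * + n
  -n≤μ*n m n = ∣i∣≤n⇒-n≤i (subst (ℕ._≤ n) (sym (ℤₚ.abs-* (μ m) (+ n))) (∣μ∣*n≤n m n))

module DegreeCounts where
  open import Data.Integer using (ℤ; +_; 0ℤ; ∣_∣; +≤+; +<+; _+_; _-_; _*_; -_; _≤_; _<_)
  open IntegerSums
  open Möbius

  degΨ : ℕ → ℕ → ℕ → ℕ
  degΨ p d k = (p ∸ 1) ℕ.* suc (d ^ k)

  ΨBound : ℕ → ℕ → ℕ → ℤ
  ΨBound p d N = ∑ (divisorsNotP p N) (λ k → + (∣ μ (N div k) ∣ ℕ.* degΨ p d k))

  degΦ* : ℕ → ℕ → ℤ
  degΦ* d n = ∑ (divisors n) (λ k → μ (n div k) * + suc (d ^ k))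

  ΨBound≤ : ∀ p d N .{{_ : NonZero d}} .{{_ : NonZero N}} → ΨBound p d N ≤ + (N ℕ.* degΨ p d N)
  ΨBound≤ p d N = ℤₚ.≤-trans (∑-≤-length* (divisorsNotP p N) (degΨ p d N) term≤)
                             (+≤+ (ℕₚ.*-monoˡ-≤ (degΨ p d N) (length-divisorsNotP p N)))
    where
    term≤ : ∀ {k} → k ∈ divisorsNotP p N → + (∣ μ (N div k) ∣ ℕ.* degΨ p d k) ≤ + degΨ p d N
    term≤ {k} k∈ = +≤+ (ℕₚ.≤-trans (∣μ∣*n≤n (N div k) (degΨ p d k))
      (ℕₚ.*-monoʳ-≤ (p ∸ 1) (s≤s (ℕₚ.^-monoʳ-≤ d (∣⇒≤ (∈-divisorsNotP⁻ p N k∈))))))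

  degΦ*≥ : ∀ d M .{{_ : NonZero d}} .{{_ : NonZero M}} →
           + suc (d ^ M) - + (suc ⌊ M /2⌋ ℕ.* suc (d ^ ⌊ M /2⌋)) ≤ degΦ* d M
  degΦ*≥ d M = begin
    + suc (d ^ M) - + (suc H ℕ.* B)
      ≡⟨ solve 2 (λ e b → e :- b := (:- b :+ con 0ℤ) :+ (e :+ con 0ℤ)) refl (+ suc (d ^ M)) (+ (suc H ℕ.* B)) ⟩
    (- + (suc H ℕ.* B) + 0ℤ) + (+ suc (d ^ M) + 0ℤ)
      ≤⟨ ℤₚ.+-mono-≤ (ℤₚ.+-mono-≤ lower-part upper-part) (ℤₚ.≤-reflexive (cong (_+ 0ℤ) (sym top))) ⟩
    (∑ (upTo (suc H)) term + ∑ (applyUpTo (suc H ℕ.+_) T) term) + ∑ (M ∷ []) term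
      ≡⟨ cong (_+ ∑ (M ∷ []) term) (trans (sym (∑-++ (upTo (suc H)) _ term))
                                      (cong (λ ks → ∑ ks term) (sym upTo-M))) ⟩
    ∑ (upTo M) term + ∑ (M ∷ []) term
      ≡⟨ trans (sym (∑-++ (upTo M) (M ∷ []) term)) (cong (λ ks → ∑ ks term) (upTo-∷ʳ M)) ⟩
    ∑ (upTo (suc M)) term
      ≡⟨ ∑-filter (_∣? M) (upTo (suc M)) _ ⟨
    degΦ* d M ∎
    where
    open ℤₚ.≤-Reasoning
    open +-*-Solver using (solve; _:=_; _:+_; _:-_; :-_; con)
    H = ⌊ M /2⌋
    B = suc (d ^ H)
    T = M ∸ suc H

    term : ℕ → ℤ
    term k = if does (k ∣? M) then μ (M div k) * + suc (d ^ k) else 0ℤ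

    upTo-M : upTo M ≡ upTo (suc H) ++ applyUpTo (suc H ℕ.+_) T
    upTo-M = trans (cong upTo (sym (ℕₚ.m+[n∸m]≡n (⌊n/2⌋<n M)))) (applyUpTo-+ (λ k → k) (suc H) T)

    top : (if does (M ∣? M) then μ (M div M) * + suc (d ^ M) else 0ℤ) ≡ + suc (d ^ M)
    top rewrite dec-true (M ∣? M) ∣-refl =
      trans (cong (λ q → μ q * + suc (d ^ M)) (n-div-n≡1 M)) (ℤₚ.*-identityˡ _)

    lower-part : - + (suc H ℕ.* B) ≤ ∑ (upTo (suc H)) term
    lower-part = subst (λ l → - + (l ℕ.* B) ≤ ∑ (upTo (suc H)) term) (length-upTo (suc H))
      (∑-≥-length* (upTo (suc H)) B λ {k} k∈ → term≥ k (∈-upTo⁻ k∈) (k ∣? M))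
      where
      term≥ : ∀ k → k ℕ.< suc H → (k∣M? : Dec (k ∣ M)) →
              - + B ≤ (if does k∣M? then μ (M div k) * + suc (d ^ k) else 0ℤ)
      term≥ k (s≤s k≤H) (yes _) = ℤₚ.≤-trans (ℤₚ.neg-mono-≤ (+≤+ (s≤s (ℕₚ.^-monoʳ-≤ d k≤H))))
                                             (-n≤μ*n (M div k) (suc (d ^ k)))
      term≥ k _         (no _)  = ℤₚ.neg-≤-pos

    upper-part : 0ℤ ≤ ∑ (applyUpTo (suc H ℕ.+_) T) term
    upper-part = ∑-nonneg (applyUpTo (suc H ℕ.+_) T) λ {k} k∈ → term≥0 k (k ∣? M) (∈-applyUpTo⁻ (suc H ℕ.+_) k∈)
      where
      term≥0 : ∀ k → (k∣M? : Dec (k ∣ M)) → ∃ (λ i → i ℕ.< T × k ≡ suc H ℕ.+ i) →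
               0ℤ ≤ (if does k∣M? then μ (M div k) * + suc (d ^ k) else 0ℤ)
      term≥0 k (yes k∣M) (i , i<T , refl) = ⊥-elim (ℕₚ.<⇒≱ (s≤s (ℕₚ.m≤m+n H i))
        (proper-divisor≤⌊n/2⌋ k∣M (subst (k ℕ.<_) (ℕₚ.m+[n∸m]≡n (⌊n/2⌋<n M)) (ℕₚ.+-monoʳ-< (suc H) i<T))))
      term≥0 k (no _)    _                = ℤₚ.≤-refl

  large-case-inequality : ∀ p d N .{{_ : NonZero d}} .{{_ : NonZero N}} → 2 ℕ.≤ p →
    let H = ⌊ p ℕ.* N /2⌋ in 3 ℕ.* suc H ℕ.≤ d ^ H →
    N ℕ.* degΨ p d N ℕ.+ suc H ℕ.* suc (d ^ H) ℕ.< suc (d ^ (p ℕ.* N))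
  large-case-inequality p d N 2≤p large = begin-strict
    N ℕ.* ((p ∸ 1) ℕ.* suc (d ^ N)) ℕ.+ suc H ℕ.* suc X
      ≡⟨ cong (ℕ._+ suc H ℕ.* suc X) (sym (ℕₚ.*-assoc N (p ∸ 1) _)) ⟩
    N ℕ.* (p ∸ 1) ℕ.* suc (d ^ N) ℕ.+ suc H ℕ.* suc X
      ≤⟨ ℕₚ.+-monoˡ-≤ _ (ℕₚ.*-mono-≤ (n[p∸1]≤2⌊pn/2⌋ p N) (s≤s (ℕₚ.^-monoʳ-≤ d (n≤⌊pn/2⌋ p N 2≤p)))) ⟩
    (H ℕ.+ H) ℕ.* suc X ℕ.+ suc H ℕ.* suc X
      ≡⟨ ℕₚ.*-distribʳ-+ (suc X) (H ℕ.+ H) (suc H) ⟨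
    (H ℕ.+ H ℕ.+ suc H) ℕ.* suc X
      <⟨ 3[H+1]≤X⇒[3H+1][X+1]<X²+1 H X large ⟩
    suc (X ℕ.* X)
      ≡⟨ cong suc (ℕₚ.^-distribˡ-+-* d H H) ⟨
    suc (d ^ (H ℕ.+ H))
      ≤⟨ s≤s (ℕₚ.^-monoʳ-≤ d (⌊n/2⌋+⌊n/2⌋≤n (p ℕ.* N))) ⟩
    suc (d ^ (p ℕ.* N)) ∎
    where
    open ℕₚ.≤-Reasoning
    H = ⌊ p ℕ.* N /2⌋
    X = d ^ H

  ΨBound<degΦ*-large : ∀ p d N .{{_ : NonZero d}} .{{_ : NonZero N}} → 2 ℕ.≤ p →
    3 ℕ.* suc ⌊ p ℕ.* N /2⌋ ℕ.≤ d ^ ⌊ p ℕ.* N /2⌋ → ΨBound p d N < degΦ* d (p ℕ.* N)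
  ΨBound<degΦ*-large p d N 2≤p large = begin-strict
    ΨBound p d N                          ≤⟨ ΨBound≤ p d N ⟩
    + a                                   ≡⟨ solve 2 (λ a c → a := a :+ c :- c) refl (+ a) (+ c) ⟩
    + a + + c - + c                       ≡⟨ cong (_- + c) (ℤₚ.pos-+ a c) ⟨
    + (a ℕ.+ c) - + c                     <⟨ ℤₚ.+-monoˡ-< (- + c) (+<+ (large-case-inequality p d N 2≤p large)) ⟩
    + suc (d ^ (p ℕ.* N)) - + c           ≤⟨ degΦ*≥ d (p ℕ.* N) ⟩
    degΦ* d (p ℕ.* N)                     ∎
    where
    open ℤₚ.≤-Reasoning
    open +-*-Solver using (solve; _:=_; _:+_; _:-_)
    a = N ℕ.* degΨ p d N
    c = suc ⌊ p ℕ.* N /2⌋ ℕ.* suc (d ^ ⌊ p ℕ.* N /2⌋)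
    instance
      pN≢0 : NonZero (p ℕ.* N)
      pN≢0 = ℕₚ.m*n≢0 p N {{ℕ.>-nonZero (ℕₚ.<-≤-trans (s≤s z≤n) 2≤p)}}

  private
    Claim : ℕ → ℕ → ℕ → Set
    Claim d p N = 2 ℕ.≤ d → Prime p → 1 ℕ.≤ N → (d ≡ 2 → 1 ℕ.< N) → ΨBound p d N < degΦ* d (p ℕ.* N)

    claim? : ∀ d p N → Dec (Claim d p N)
    claim? d p N = 2 ℕ.≤? d →-dec prime? p →-dec 1 ℕ.≤? N →-dec (d ℕ.≟ 2 →-dec 1 ℕ.<? N) →-dec
                   ΨBound p d N ℤₚ.<? degΦ* d (p ℕ.* N)

  ΨBound<degΦ*-small : ∀ {d p N} → d ℕ.< 12 → p ℕ.< 8 → N ℕ.< 8 →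
    2 ℕ.≤ d → Prime p → 1 ℕ.≤ N → (d ≡ 2 → 1 ℕ.< N) → ΨBound p d N < degΦ* d (p ℕ.* N)
  ΨBound<degΦ*-small d<12 p<8 N<8 =
    toWitness {a? = ℕₚ.allUpTo? (λ d → ℕₚ.allUpTo? (λ p → ℕₚ.allUpTo? (claim? d p) 8) 8) 12} _ d<12 p<8 N<8

  ΨBound<degΦ* : ∀ p d N → 2 ℕ.≤ d → Prime p → 1 ℕ.≤ N → (d ≡ 2 → 1 ℕ.< N) →
    ΨBound p d N < degΦ* d (p ℕ.* N)
  ΨBound<degΦ* p d N 2≤d p-prime 1≤N d≡2⇒1<N
    with 3 ℕ.* suc ⌊ p ℕ.* N /2⌋ ℕ.≤? d ^ ⌊ p ℕ.* N /2⌋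
  ... | yes large = ΨBound<degΦ*-large p d N {{d≢0}} {{ℕ.>-nonZero 1≤N}} (prime⇒2≤p p-prime) large
    where d≢0 = ℕ.>-nonZero (ℕₚ.<-≤-trans (s≤s z≤n) 2≤d)
  ... | no small with small-parameters p d N (prime⇒2≤p p-prime) 2≤d 1≤N small
  ...   | d<12 , p<8 , N<8 = ΨBound<degΦ*-small d<12 p<8 N<8 2≤d p-prime 1≤N d≡2⇒1<N

module FixedPoints {c ℓ : Level} (𝔽 : Field c ℓ) where
  open FieldDefs 𝔽
  open Field 𝔽 renaming (refl to ≈-refl; sym to ≈-sym; trans to ≈-trans)
  open import Data.Sum using (_⊎_; inj₁; inj₂)
  open import Data.List.Relation.Unary.All using ([]; _∷_)
  open import Data.List.Relation.Unary.AllPairs using ([]; _∷_)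
  open import Algebra.Properties.Ring ring using (-‿involutive; -0#≈0#; -‿distribˡ-*; x[y-z]≈xy-xz)
  open import Algebra.Properties.AbelianGroup +-abelianGroup
    using (x∙y⁻¹≈ε⇒x≈y; x≈y⇒x∙y⁻¹≈ε; ⁻¹-∙-comm; ∙-cancelʳ)
  open import Relation.Binary.Reasoning.Setoid setoid
  open import Algebra.Solver.Ring.NaturalCoefficients.Default commutativeSemiring
    using (solve; _:=_; _:+_; _:*_; con)

  x*y≈0⇒y≈0 : ∀ {x y} → ¬ (x ≈ 0#) → x * y ≈ 0# → y ≈ 0#
  x*y≈0⇒y≈0 {x} {y} x≉0 xy≈0 with inverse x x≉0
  ... | x⁻¹ , xx⁻¹≈1 = begin
    y               ≈⟨ ≈-sym (*-identityˡ y) ⟩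
    1# * y          ≈⟨ *-congʳ (≈-sym xx⁻¹≈1) ⟩
    (x * x⁻¹) * y   ≈⟨ *-congʳ (*-comm x x⁻¹) ⟩
    (x⁻¹ * x) * y   ≈⟨ *-assoc x⁻¹ x y ⟩
    x⁻¹ * (x * y)   ≈⟨ *-congˡ xy≈0 ⟩
    x⁻¹ * 0#        ≈⟨ zeroʳ x⁻¹ ⟩
    0#              ∎

  x*y≈0⇒x≈0 : ∀ {x y} → ¬ (y ≈ 0#) → x * y ≈ 0# → x ≈ 0#
  x*y≈0⇒x≈0 {x} {y} y≉0 xy≈0 = x*y≈0⇒y≈0 y≉0 (≈-trans (*-comm y x) xy≈0)

  linAt : K → K → Pt → K
  linAt u v (x , y) = u * x + v * y

  x≈0⇒y*x≈0 : ∀ {x} y → x ≈ 0# → y * x ≈ 0#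
  x≈0⇒y*x≈0 y x≈0 = ≈-trans (*-congˡ x≈0) (zeroʳ y)

  x≈0⇒x*y≈0 : ∀ {x y} → x ≈ 0# → x * y ≈ 0#
  x≈0⇒x*y≈0 {x} {y} x≈0 = ≈-trans (*-comm x y) (x≈0⇒y*x≈0 y x≈0)

  distinct-zeros⇒zero-form : ∀ {u v} P Q → ¬ SamePt P Q →
    linAt u v P ≈ 0# → linAt u v Q ≈ 0# → (u ≈ 0#) × (v ≈ 0#)
  distinct-zeros⇒zero-form {u} {v} (x₁ , y₁) (x₂ , y₂) P≠Q ℓP≈0 ℓQ≈0 =
    annihilates-cross-products u-cross , annihilates-cross-products v-cross
    where
    annihilates-cross-products : ∀ {w} → w * (x₁ * y₂) ≈ w * (x₂ * y₁) → w ≈ 0#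
    annihilates-cross-products {w} w-cross = x*y≈0⇒x≈0 (P≠Q ∘ x∙y⁻¹≈ε⇒x≈y _ _)
      (≈-trans (x[y-z]≈xy-xz w _ _) (x≈y⇒x∙y⁻¹≈ε w-cross))

    u-cross : u * (x₁ * y₂) ≈ u * (x₂ * y₁)
    u-cross = ∙-cancelʳ (v * (y₁ * y₂)) _ _ (begin
      u * (x₁ * y₂) + v * (y₁ * y₂)
        ≈⟨ solve 6 (λ u v x₁ y₁ x₂ y₂ → u :* (x₁ :* y₂) :+ v :* (y₁ :* y₂) := y₂ :* (u :* x₁ :+ v :* y₁))
                 ≈-refl u v x₁ y₁ x₂ y₂ ⟩
      y₂ * linAt u v (x₁ , y₁)  ≈⟨ x≈0⇒y*x≈0 y₂ ℓP≈0 ⟩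
      0#                        ≈⟨ x≈0⇒y*x≈0 y₁ ℓQ≈0 ⟨
      y₁ * linAt u v (x₂ , y₂)
        ≈⟨ solve 6 (λ u v x₁ y₁ x₂ y₂ → y₁ :* (u :* x₂ :+ v :* y₂) := u :* (x₂ :* y₁) :+ v :* (y₁ :* y₂))
                 ≈-refl u v x₁ y₁ x₂ y₂ ⟩
      u * (x₂ * y₁) + v * (y₁ * y₂) ∎)

    v-cross : v * (x₁ * y₂) ≈ v * (x₂ * y₁)
    v-cross = ∙-cancelʳ (u * (x₁ * x₂)) _ _ (begin
      v * (x₁ * y₂) + u * (x₁ * x₂)
        ≈⟨ solve 6 (λ u v x₁ y₁ x₂ y₂ → v :* (x₁ :* y₂) :+ u :* (x₁ :* x₂) := x₁ :* (u :* x₂ :+ v :* y₂))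
                 ≈-refl u v x₁ y₁ x₂ y₂ ⟩
      x₁ * linAt u v (x₂ , y₂)  ≈⟨ x≈0⇒y*x≈0 x₁ ℓQ≈0 ⟩
      0#                        ≈⟨ x≈0⇒y*x≈0 x₂ ℓP≈0 ⟨
      x₂ * linAt u v (x₁ , y₁)
        ≈⟨ solve 6 (λ u v x₁ y₁ x₂ y₂ → x₂ :* (u :* x₁ :+ v :* y₁) := v :* (x₂ :* y₁) :+ u :* (x₁ :* x₂))
                 ≈-refl u v x₁ y₁ x₂ y₂ ⟩
      v * (x₂ * y₁) + u * (x₁ * x₂) ∎)

  IsScalar-h^1 : ∀ {h} → β h ≈ 0# → γ h ≈ 0# → α h ≈ δ h → IsScalar (h ^M 1)
  IsScalar-h^1 {h} β≈0 γ≈0 α≈δ =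
    ≈-trans (solve 2 (λ α β → α :* con 0 :+ β :* con 1 := β) ≈-refl (α h) (β h)) β≈0 ,
    ≈-trans (solve 2 (λ γ δ → γ :* con 1 :+ δ :* con 0 := γ) ≈-refl (γ h) (δ h)) γ≈0 ,
    ≈-trans (solve 2 (λ α β → α :* con 1 :+ β :* con 0 := α) ≈-refl (α h) (β h))
          (≈-trans α≈δ (solve 2 (λ γ δ → δ := γ :* con 0 :+ δ :* con 1) ≈-refl (γ h) (δ h)))

  factor-products-vanish : ∀ {a b a' b'} → (a ≈ 0# × b ≈ 0#) ⊎ (a' ≈ 0# × b' ≈ 0#) →
    (a * a' ≈ 0#) × (b * a' + a * b' ≈ 0#) × (b * b' ≈ 0#)
  factor-products-vanish {a} {b} {a'} {b'} (inj₁ (a≈0 , b≈0)) =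
    x≈0⇒x*y≈0 a≈0 , ≈-trans (+-cong (x≈0⇒x*y≈0 b≈0) (x≈0⇒x*y≈0 a≈0)) (+-identityʳ 0#) , x≈0⇒x*y≈0 b≈0
  factor-products-vanish {a} {b} {a'} {b'} (inj₂ (a'≈0 , b'≈0)) =
    x≈0⇒y*x≈0 a a'≈0 , ≈-trans (+-cong (x≈0⇒y*x≈0 b a'≈0) (x≈0⇒y*x≈0 a b'≈0)) (+-identityʳ 0#) , x≈0⇒y*x≈0 b b'≈0

  module _ {h : Mat} {a b a' b' : K} (split : fixForm h ≈F (lin a b *F lin a' b')) where

    private
      minus-cong : ∀ {x x' y y'} → x ≈ x' → y ≈ y' → x - y ≈ x' - y'
      minus-cong x≈x' y≈y' = +-cong x≈x' (-‿cong y≈y')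

    γ≈aa′ : γ h ≈ a * a'
    γ≈aa′ = begin
      γ h                ≈⟨ +-identityʳ (γ h) ⟨
      γ h + 0#           ≈⟨ +-congˡ -0#≈0# ⟨
      γ h - 0#
        ≈⟨ minus-cong (solve 2 (λ γ δ → con 0 :* con 0 :+ con 1 :* γ :+ con 0 :* δ := γ) ≈-refl (γ h) (δ h))
                      (solve 2 (λ α β → con 1 :* con 0 :+ con 0 :* α :+ con 0 :* β := con 0) ≈-refl (α h) (β h)) ⟨
      _                  ≈⟨ proj₂ split 2 ⟩
      b * 0# + a * a' + 0# * b'  ≈⟨ solve 4 (λ a b a' b' → b :* con 0 :+ a :* a' :+ con 0 :* b' := a :* a') ≈-refl a b a' b' ⟩
      a * a'             ∎

    δ-α≈ba′+ab′ : δ h - α h ≈ b * a' + a * b'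
    δ-α≈ba′+ab′ = ≈-trans
      (≈-sym (minus-cong (solve 2 (λ γ δ → con 0 :* γ :+ con 1 :* δ := δ) ≈-refl (γ h) (δ h))
                         (solve 2 (λ α β → con 1 :* α :+ con 0 :* β := α) ≈-refl (α h) (β h))))
      (proj₂ split 1)

    -β≈bb′ : - β h ≈ b * b'
    -β≈bb′ = begin
      - β h              ≈⟨ +-identityˡ (- β h) ⟨
      0# - β h           ≈⟨ minus-cong (solve 1 (λ δ → con 0 :* δ := con 0) ≈-refl (δ h))
                                       (solve 1 (λ β → con 1 :* β := β) ≈-refl (β h)) ⟨
      _                  ≈⟨ proj₂ split 0 ⟩
      b * b'             ∎

    fixedPoint⇒factors-vanish : ∀ {P} → IsFixed h P → linAt a b P * linAt a' b' P ≈ 0#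
    fixedPoint⇒factors-vanish {x , y} (_ , fixed) = begin
      (a * x + b * y) * (a' * x + b' * y)
        ≈⟨ solve 6 (λ a b a' b' x y → (a :* x :+ b :* y) :* (a' :* x :+ b' :* y)
                     := a :* a' :* (x :* x) :+ (b :* a' :+ a :* b') :* (x :* y) :+ b :* b' :* (y :* y)) ≈-refl a b a' b' x y ⟩
      a * a' * (x * x) + (b * a' + a * b') * (x * y) + b * b' * (y * y)
        ≈⟨ +-cong (+-cong (*-congʳ γ≈aa′) (*-congʳ δ-α≈ba′+ab′)) (*-congʳ -β≈bb′) ⟨
      γ h * (x * x) + (δ h - α h) * (x * y) + (- β h) * (y * y)
        ≈⟨ solve 6 (λ γ δ -α -β x y → γ :* (x :* x) :+ (δ :+ -α) :* (x :* y) :+ -β :* (y :* y)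
                     := x :* (γ :* x :+ δ :* y) :+ (-α :* (x :* y) :+ -β :* (y :* y))) ≈-refl (γ h) (δ h) (- α h) (- β h) x y ⟩
      x * (γ h * x + δ h * y) + ((- α h) * (x * y) + (- β h) * (y * y))
        ≈⟨ +-congˡ (+-cong (-‿distribˡ-* (α h) (x * y)) (-‿distribˡ-* (β h) (y * y))) ⟨
      x * (γ h * x + δ h * y) + (- (α h * (x * y)) - β h * (y * y))
        ≈⟨ +-congˡ (≈-trans (⁻¹-∙-comm _ _) (-‿cong (solve 4 (λ α β x y → α :* (x :* y) :+ β :* (y :* y)
                                                                := y :* (α :* x :+ β :* y)) ≈-refl (α h) (β h) x y))) ⟩
      x * (γ h * x + δ h * y) - y * (α h * x + β h * y)
        ≈⟨ x≈y⇒x∙y⁻¹≈ε fixed ⟩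
      0# ∎

    vanishing-factor⇒scalar : (a ≈ 0# × b ≈ 0#) ⊎ (a' ≈ 0# × b' ≈ 0#) → IsScalar (h ^M 1)
    vanishing-factor⇒scalar vanishing with factor-products-vanish vanishing
    ... | aa′≈0 , ba′+ab′≈0 , bb′≈0 = IsScalar-h^1
      (≈-trans (≈-sym (-‿involutive (β h))) (≈-trans (-‿cong (≈-trans -β≈bb′ bb′≈0)) -0#≈0#))
      (≈-trans γ≈aa′ aa′≈0)
      (≈-sym (x∙y⁻¹≈ε⇒x≈y _ _ (≈-trans δ-α≈ba′+ab′ ba′+ab′≈0)))

  no-three-fixed-points : ∀ {h} → ¬ IsScalar (h ^M 1) → FixDefinedOverK h →
    ∀ {P Q R} → IsFixed h P → IsFixed h Q → IsFixed h R →
    ¬ SamePt P Q → ¬ SamePt P R → ¬ SamePt Q R → ⊥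
  no-three-fixed-points {h} h≉1 (a , b , a' , b' , split) {P} {Q} {R} fixP fixQ fixR P≠Q P≠R Q≠R =
    ¬¬-excluded-middle λ ℓP? → ¬¬-excluded-middle λ ℓQ? → ¬¬-excluded-middle λ ℓR? →
    pigeonhole ℓP? ℓQ? ℓR?
    where
    ℓ₁ : Pt → K
    ℓ₁ = linAt a b

    common-zero : ∀ {S T} → ¬ SamePt S T → ℓ₁ S ≈ 0# → ℓ₁ T ≈ 0# → ⊥
    common-zero {S} {T} S≠T ℓS≈0 ℓT≈0 =
      h≉1 (vanishing-factor⇒scalar split (inj₁ (distinct-zeros⇒zero-form S T S≠T ℓS≈0 ℓT≈0)))

    common-nonzero : ∀ {S T} → IsFixed h S → IsFixed h T → ¬ SamePt S T →
                     ¬ (ℓ₁ S ≈ 0#) → ¬ (ℓ₁ T ≈ 0#) → ⊥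
    common-nonzero {S} {T} fixS fixT S≠T ℓS≉0 ℓT≉0 =
      h≉1 (vanishing-factor⇒scalar split (inj₂ (distinct-zeros⇒zero-form S T S≠T
        (x*y≈0⇒y≈0 ℓS≉0 (fixedPoint⇒factors-vanish split fixS))
        (x*y≈0⇒y≈0 ℓT≉0 (fixedPoint⇒factors-vanish split fixT)))))

    -- The goal is ⊥, so we may decide whether ℓ₁ vanishes at P, Q and R; two of the three points
    -- are then zeros of the same linear factor.
    pigeonhole : Dec (ℓ₁ P ≈ 0#) → Dec (ℓ₁ Q ≈ 0#) → Dec (ℓ₁ R ≈ 0#) → ⊥
    pigeonhole (yes ℓP≈0) (yes ℓQ≈0) _          = common-zero P≠Q ℓP≈0 ℓQ≈0
    pigeonhole (yes ℓP≈0) (no _)     (yes ℓR≈0) = common-zero P≠R ℓP≈0 ℓR≈0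
    pigeonhole (yes _)    (no ℓQ≉0)  (no ℓR≉0)  = common-nonzero fixQ fixR Q≠R ℓQ≉0 ℓR≉0
    pigeonhole (no _)     (yes ℓQ≈0) (yes ℓR≈0) = common-zero Q≠R ℓQ≈0 ℓR≈0
    pigeonhole (no ℓP≉0)  (yes _)    (no ℓR≉0)  = common-nonzero fixP fixR P≠R ℓP≉0 ℓR≉0
    pigeonhole (no ℓP≉0)  (no ℓQ≉0)  _          = common-nonzero fixP fixQ P≠Q ℓP≉0 ℓQ≉0

  fixList-length≤2 : ∀ {h pts} → ¬ IsScalar (h ^M 1) → FixDefinedOverK h → IsFixList h pts →
                     length pts ℕ.≤ 2
  fixList-length≤2 {pts = []}                _   _     _ = z≤n
  fixList-length≤2 {pts = _ ∷ []}            _   _     _ = s≤s z≤n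
  fixList-length≤2 {pts = _ ∷ _ ∷ []}        _   _     _ = s≤s (s≤s z≤n)
  fixList-length≤2 {pts = _ ∷ _ ∷ _ ∷ _} h≉1 fixK
    (fixP ∷ fixQ ∷ fixR ∷ _ , (P≠Q ∷ P≠R ∷ _) ∷ (Q≠R ∷ _) ∷ _ , _) =
    ⊥-elim (no-three-fixed-points h≉1 fixK fixP fixQ fixR P≠Q P≠R Q≠R)

module FormDegrees {c ℓ : Level} (𝔽 : Field c ℓ) where
  open FieldDefs 𝔽
  open import Data.Integer using (ℤ; +_; 0ℤ; +≤+; _+_; _-_; _*_; _≤_)
  open IntegerSums
  open AbsoluteValue
  open DegreeCounts

  deg-iterate : ∀ F G k → deg (proj₁ (iter F G k)) ≡ deg F ^ k
  deg-iterate F G zero    = refl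
  deg-iterate F G (suc k) = cong (deg F ℕ.*_) (deg-iterate F G k)

  deg-ptLin^ : ∀ P m → deg (ptLin P ^F m) ≡ m
  deg-ptLin^ P zero    = refl
  deg-ptLin^ P (suc m) = cong suc (deg-ptLin^ P m)

  IsOrd⇒≤deg : ∀ {f P m} → IsOrd f P m → m ℕ.≤ deg f
  IsOrd⇒≤deg {f} {P} {m} ((q , deg≡ , _) , _) =
    subst (m ℕ.≤_) deg≡ (subst (ℕ._≤ deg (ptLin P ^F m) ℕ.+ deg q) (deg-ptLin^ P m) (ℕₚ.m≤m+n _ _))

  degPhiStar≡degΦ* : ∀ F G n → degPhiStar F G n ≡ degΦ* (deg F) n
  degPhiStar≡degΦ* F G n = ∑-cong (divisors n) λ k → cong (λ e → μ (n div k) * + suc e) (deg-iterate F G k)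

  degPsiStar≡ : ∀ F G h p N →
    degPsiStar F G h p N ≡ ∑ (divisorsNotP p N) (λ k → μ (N div k) * + degΨ p (deg F) k)
  degPsiStar≡ F G h p N = ∑-cong (divisorsNotP p N) λ k → cong (μ (N div k) *_) (begin
    ∑ (range1 p) (λ j → + deg (psiForm F G h k j))  ≡⟨ ∑-cong (range1 p) (λ _ → cong (+_ ∘ suc) (deg-iterate F G k)) ⟩
    ∑ (range1 p) (λ _ → + suc (deg F ^ k))          ≡⟨ ∑-const (range1 p) _ ⟩
    + (length (range1 p) ℕ.* suc (deg F ^ k))      ≡⟨ cong (λ l → + (l ℕ.* suc (deg F ^ k))) (length-range1 p) ⟩
    + degΨ p (deg F) k                             ∎)
    where open ≡-Reasoning

  degPsiTilde≤ΨBound : ∀ F G h p N pts ord → length pts ℕ.≤ 2 →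
    (∀ k j P → k ∣ N → 1 ℕ.≤ j → j ℕ.< p → P ∈ pts → IsOrd (psiForm F G h k j) P (ord k j P)) →
    degPsiTilde F G h p N pts ord ≤ ΨBound p (deg F) N
  degPsiTilde≤ΨBound F G h p N pts ord |pts|≤2 isOrd = begin
    degPsiTilde F G h p N pts ord
      ≡⟨ cong₂ _-_ (degPsiStar≡ F G h p N)
                   (trans (∑-comm pts D′ λ P k → m k * O k P) (∑-cong D′ λ k → ∑-*ˡ pts (m k) (O k))) ⟩
    ∑ D′ (λ k → m k * + S k) - ∑ D′ (λ k → m k * σ k)
      ≡⟨ ∑-distrib-- D′ (λ k → m k * + S k) (λ k → m k * σ k) ⟨
    ∑ D′ (λ k → m k * + S k - m k * σ k)
      ≤⟨ ∑-mono-≤ D′ (λ {k} k∈D′ → m*s-m*σ≤∣m∣*s (m k) (S k) (σ≥0 k) (σ≤2S k∈D′)) ⟩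
    ΨBound p (deg F) N ∎
    where
    open ℤₚ.≤-Reasoning
    D′ = divisorsNotP p N
    m : ℕ → ℤ
    m k = μ (N div k)
    S : ℕ → ℕ
    S k = degΨ p (deg F) k
    O : ℕ → Pt → ℤ
    O k P = ∑ (range1 p) (λ j → + ord k j P)
    σ : ℕ → ℤ
    σ k = ∑ pts (O k)

    O≤S : ∀ {k P} → k ∈ D′ → P ∈ pts → O k P ≤ + S k
    O≤S {k} {P} k∈D′ P∈pts = subst (λ l → O k P ≤ + (l ℕ.* suc (deg F ^ k))) (length-range1 p)
      (∑-≤-length* (range1 p) (suc (deg F ^ k)) ord≤deg)
      where
      ord≤deg : ∀ {j} → j ∈ range1 p → + ord k j P ≤ + suc (deg F ^ k)
      ord≤deg {j} j∈ = let 1≤j , j<p = ∈-range1⁻ p j∈ in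
        +≤+ (subst (ord k j P ℕ.≤_) (cong suc (deg-iterate F G k))
                   (IsOrd⇒≤deg (isOrd k j P (∈-divisorsNotP⁻ p N k∈D′) 1≤j j<p P∈pts)))

    σ≥0 : ∀ k → 0ℤ ≤ σ k
    σ≥0 k = ∑-nonneg pts {O k} λ _ → ∑-nonneg (range1 p) λ _ → +≤+ z≤n

    σ≤2S : ∀ {k} → k ∈ D′ → σ k ≤ + S k + + S k
    σ≤2S {k} k∈D′ = begin
      σ k                    ≤⟨ ∑-≤-length* pts (S k) (O≤S k∈D′) ⟩
      + (length pts ℕ.* S k) ≤⟨ +≤+ (ℕₚ.*-monoˡ-≤ (S k) |pts|≤2) ⟩
      + (2 ℕ.* S k)          ≡⟨ cong +_ (cong (S k ℕ.+_) (ℕₚ.+-identityʳ (S k))) ⟩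
      + (S k ℕ.+ S k)        ≡⟨ ℤₚ.pos-+ (S k) (S k) ⟩
      + S k + + S k          ∎

open import Data.Nat using (ℕ; _≤_; _<_; _*_)
open import Data.Nat.Divisibility using (_∣_)
open import Data.Nat.Primality using (Prime)
open import Data.List using (List)
open import Data.List.Membership.Propositional using (_∈_)
open import Relation.Binary.PropositionalEquality using (_≡_)

mainTheorem12 :
    ∀ {c ℓ : Level} (𝔽 : Field c ℓ) → let open FieldDefs 𝔽 in
    (d : ℕ) (F G : Form) → deg F ≡ d → deg G ≡ d → 2 ≤ d → CoprimeF F G →
    (h : Mat) (p : ℕ) → Prime p → HasOrder h p → IsAut F G h →
    FixDefinedOverK h →
    (pts : List Pt) → IsFixList h pts →
    (N : ℕ) → 1 ≤ N → (d ≡ 2 → 1 < N) →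
    (ord : ℕ → ℕ → Pt → ℕ) →
    (∀ k j P → k ∣ N → 1 ≤ j → j < p → P ∈ pts → IsOrd (psiForm F G h k j) P (ord k j P)) →
    degPsiTilde F G h p N pts ord <ℤ degPhiStar F G (p * N)
mainTheorem12 𝔽 _ F G refl _ 2≤d _ h p p-prime (_ , _ , h^j≉1) _ fixK pts fixList N 1≤N d≡2⇒1<N ord isOrd =
  begin-strict
    degPsiTilde F G h p N pts ord  ≤⟨ degPsiTilde≤ΨBound F G h p N pts ord |pts|≤2 isOrd ⟩
    ΨBound p (deg F) N             <⟨ ΨBound<degΦ* p (deg F) N 2≤d p-prime 1≤N d≡2⇒1<N ⟩
    degΦ* (deg F) (p * N)          ≡⟨ degPhiStar≡degΦ* F G (p * N) ⟨
    degPhiStar F G (p * N)         ∎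
  where
  open FieldDefs 𝔽
  open FixedPoints 𝔽
  open FormDegrees 𝔽
  open DegreeCounts
  open ℤₚ.≤-Reasoning
  |pts|≤2 : length pts ≤ 2
  |pts|≤2 = fixList-length≤2 (h^j≉1 1 (s≤s z≤n) (prime⇒2≤p p-prime)) fixK fixList
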